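{- Let $T$ be a treedepth decomposition of a graph $G$ that is not trivially improvable, let $X' \subseteq X \subseteq V(G)$, and let $F$ and $F'$ be the forests of the restrictions of $(T,V(T),h_T)$ to $X$ and to $X'$, respectively, where $h_T(x)$ is the height of node $x$ in $T$. Then $F$ topologically generalizes $F'$ under $X'$.
   Context: A rooted forest is a disjoint union of rooted trees; a leaf is a node without children. For a node $x$, an ancestor of $x$ is any node other than $x$ on the path from the root of its tree to $x$; descendants are defined dually. Depth of a node: number of vertices on the path from its root to it (roots have depth $1$); height of a forest: maximum depth; the height of a node $x$ is the height of the subtree $T_x$ consisting of $x$ and its descendants. A treedepth decomposition of $G$ is a rooted forest $T$ with $V(G)\subseteq V(T)$ such that for every edge $uv\in E(G)$, $u$ is an ancestor of $v$ or vice versa; it is trivially improvable if $V(G)\subsetneq V(T)$. A partial decomposition is a triple $(F,X,h)$ with $F$ a rooted forest, $X\subseteq V(F)$, and $h\colon V(F)\to\mathbb{N}^+$ with $h(x)>h(y)$ whenever $x$ is an ancestor of $y$. Its restriction to $X'\subseteq X$ is $(F',X',h|_{V(F')})$ where $F'$ is obtained by iteratively deleting leaves not in $X'$. For rooted forests $F_1,F_2$ and $X\subseteq V(F_1)\cap V(F_2)$, $F_1$ topologically generalizes $F_2$ under $X$ if there is an injective map $f\colon V(F_2)\to V(F_1)$ with $f|_X$ the identity such that for every node $x\in V(F_2)$ and every ancestor $y$ of $x$ in $F_2$, $f(y)$ is an ancestor of $f(x)$ in $F_1$. -}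

module Defs where

open import Data.Nat using (ℕ)
open import Data.Fin using (Fin)
open import Data.Fin.Subset using (Subset; _∈_; _∉_; _⊆_; ⊤; outside)
open import Data.Vec using (_[_]≔_)
open import Data.Maybe using (Maybe; just)
open import Data.Product using (Σ; _×_; proj₁)
open import Data.Sum using (_⊎_)
open import Relation.Nullary using (¬_)
open import Relation.Binary.PropositionalEquality using (_≡_)

-- A rooted forest on node set Fin m, given by a parent function
-- (nothing = root).  Ancestor y x : y is a (strict) ancestor of x.
data Ancestor {m : ℕ} (parent : Fin m → Maybe (Fin m)) : Fin m → Fin m → Set where
  par  : ∀ {x y} → parent x ≡ just y → Ancestor parent y x
  step : ∀ {x y z} → parent x ≡ just z → Ancestor parent y z → Ancestor parent y x

record Forest (m : ℕ) : Set where
  field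
    parent  : Fin m → Maybe (Fin m)
    acyclic : ∀ x → ¬ Ancestor parent x x

open Forest public

IsAncestor : ∀ {m} → Forest m → Fin m → Fin m → Set
IsAncestor T = Ancestor (parent T)

record Graph (m : ℕ) : Set₁ where
  field
    V       : Subset m
    Edge    : Fin m → Fin m → Set
    edge-V  : ∀ {u v} → Edge u v → (u ∈ V × v ∈ V)
    sym     : ∀ {u v} → Edge u v → Edge v u
    irrefl  : ∀ {u} → ¬ Edge u u

open Graph public

-- T is a treedepth decomposition of G (V(G) ⊆ V(T) = Fin m).
IsTreedepthDecomposition : ∀ {m} → Forest m → Graph m → Set
IsTreedepthDecomposition T G =
  ∀ {u v} → Edge G u v → IsAncestor T u v ⊎ IsAncestor T v u

-- trivially improvable iff V(G) ⊊ V(T)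
NotTriviallyImprovable : ∀ {m} → Forest m → Graph m → Set
NotTriviallyImprovable {m} T G = ⊤ ⊆ V G

-- Sub-forests of T obtained by deleting nodes are represented by their node
-- set S (the parent function is inherited).  x is a leaf of S: no child in S.
IsLeafIn : ∀ {m} → Forest m → Subset m → Fin m → Set
IsLeafIn T S x = x ∈ S × (∀ y → y ∈ S → ¬ (parent T y ≡ just x))

DeleteStep : ∀ {m} → Forest m → Subset m → Subset m → Subset m → Set
DeleteStep T X S S′ =
  Σ _ λ x → IsLeafIn T S x × x ∉ X × S′ ≡ (S [ x ]≔ outside)

data Deletes {m} (T : Forest m) (X : Subset m) : Subset m → Subset m → Set where
  done : ∀ {S} → Deletes T X S S
  more : ∀ {S S′ S″} → DeleteStep T X S S′ → Deletes T X S′ S″ → Deletes T X S S″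

-- S is the node set of the forest of the restriction of (T, V(T), h) to X:
-- obtained from V(T) by iteratively deleting leaves not in X, until none remain.
IsRestriction : ∀ {m} → Forest m → Subset m → Subset m → Set
IsRestriction T X S =
  Deletes T X ⊤ S × (∀ x → IsLeafIn T S x → x ∈ X)

IsAncestorIn : ∀ {m} → Forest m → Subset m → Fin m → Fin m → Set
IsAncestorIn T S y x = y ∈ S × x ∈ S × IsAncestor T y x

Node : ∀ {m} → Subset m → Set
Node S = Σ _ λ x → x ∈ S

TopGeneralizes : ∀ {m} → Forest m → Subset m → Subset m → Subset m → Set
TopGeneralizes T S₁ S₂ X =
  Σ (Node S₂ → Node S₁) λ f →
      (∀ a b → proj₁ (f a) ≡ proj₁ (f b) → proj₁ a ≡ proj₁ b)
    × (∀ a → proj₁ a ∈ X → proj₁ (f a) ≡ proj₁ a)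
    × (∀ a b → IsAncestorIn T S₂ (proj₁ b) (proj₁ a)
             → IsAncestorIn T S₁ (proj₁ (f b)) (proj₁ (f a)))

module Submission where

open import Defs
open import Data.Nat using (ℕ)
open import Data.Fin using (_≟_)
open import Data.Fin.Subset using (Subset; _⊆_; _∈_)
open import Data.Fin.Subset.Properties using (∈⊤)
open import Data.Vec.Properties using ([]≔-minimal)
open import Data.Product using (_,_)
open import Relation.Nullary using (yes; no)
open import Relation.Binary.PropositionalEquality using (refl)
open import Data.Empty using (⊥-elim)

-- The restriction to X′ is contained in the restriction to X: the first node
-- of S′ that a deletion sequence for X removed would be a leaf of S′, hence in
-- X′ ⊆ X, so it could not have been deleted.  The identity map on S′ is then
-- the required embedding.

leaf-⊆ : ∀ {m} {T : Forest m} {R S : Subset m} {x}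
       → S ⊆ R → IsLeafIn T R x → x ∈ S → IsLeafIn T S x
leaf-⊆ S⊆R (_ , childless) x∈S = x∈S , λ y y∈S → childless y (S⊆R y∈S)

module _ {m} {T : Forest m} {X S : Subset m}
         (leaves∈X : ∀ x → IsLeafIn T S x → x ∈ X) where

  deleteStep-preserves-⊆ : ∀ {R R′} → DeleteStep T X R R′ → S ⊆ R → S ⊆ R′
  deleteStep-preserves-⊆ {R} (z , z-leaf , z∉X , refl) S⊆R {y} y∈S with y ≟ z
  ... | yes refl = ⊥-elim (z∉X (leaves∈X y (leaf-⊆ {T = T} S⊆R z-leaf y∈S)))
  ... | no y≢z   = []≔-minimal R y z y≢z (S⊆R y∈S)

  deletes-preserves-⊆ : ∀ {R R′} → Deletes T X R R′ → S ⊆ R → S ⊆ R′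
  deletes-preserves-⊆ done          = λ S⊆R → S⊆R
  deletes-preserves-⊆ (more d ds) S⊆R =
    deletes-preserves-⊆ ds (deleteStep-preserves-⊆ d S⊆R)

restriction-mono : ∀ {m} {T : Forest m} {X X′ S S′ : Subset m}
                 → X′ ⊆ X → IsRestriction T X S → IsRestriction T X′ S′
                 → S′ ⊆ S
restriction-mono X′⊆X (⊤↝S , _) (_ , leaves∈X′) =
  deletes-preserves-⊆ (λ x leaf → X′⊆X (leaves∈X′ x leaf)) ⊤↝S (λ _ → ∈⊤)

⊆⇒TopGeneralizes : ∀ {m} (T : Forest m) {S S′ : Subset m} (Y : Subset m)
                 → S′ ⊆ S → TopGeneralizes T S S′ Y
⊆⇒TopGeneralizes _ _ S′⊆S =
    (λ (x , x∈S′) → x , S′⊆S x∈S′)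
  , (λ _ _ x≡y → x≡y)
  , (λ _ _ → refl)
  , (λ _ _ (y∈S′ , x∈S′ , y<x) → S′⊆S y∈S′ , S′⊆S x∈S′ , y<x)

mainTheorem14 : ∀ (m : ℕ) (T : Forest m) (G : Graph m)
    → IsTreedepthDecomposition T G
    → NotTriviallyImprovable T G
    → (X X′ : Subset m) → X′ ⊆ X → X ⊆ V G
    → (S S′ : Subset m) → IsRestriction T X S → IsRestriction T X′ S′
    → TopGeneralizes T S S′ X′
mainTheorem14 _ T _ _ _ _ X′ X′⊆X _ _ _ restrS restrS′ =
  ⊆⇒TopGeneralizes T X′ (restriction-mono X′⊆X restrS restrS′)
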